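{- Let $c>0$ be a sufficiently large constant, $p=c/k$, and let $G=G_k$ be a graph on $n$ vertices with minimum degree at least $k$. When the DFS-algorithm is run on $G_p$, a.a.s. (as $k\to\infty$) at most $\frac{2n}{p}=\frac{2nk}{c}$ edges of $G$ are tested.
   Context: For a graph $G$ and $p\in[0,1]$, $G_p$ is obtained from $G$ by deleting each edge independently with probability $1-p$. The DFS-algorithm on $G_p$ (with $G$ known) maintains a partition of $V(G)$ into sets $R$ (fully explored), $S$ (a stack, vertices under exploration) and $U$ (unvisited), starting with $U=V(G)$, $R=S=\emptyset$. In each round: if $S=\emptyset$, some vertex of $U$ is moved to $S$ (becoming the root of a new tree); otherwise, for the top vertex $v$ of $S$, the algorithm queries, for neighbours $w\in U$ of $v$ in $G$, whether $vw$ is an edge of $G_p$ (each query answered positively independently with probability $p$); upon the first positive answer $w$ is pushed onto $S$, and if no neighbour of $v$ in $U$ (in $G$) is adjacent to $v$ in $G_p$, then $v$ is moved to $R$. The algorithm stops when $R=V(G)$ and outputs a rooted spanning forest $T$ of $G_p$. An edge of $G$ is tested if the algorithm queried whether it is in $G_p$, and untested otherwise. The choices of new roots and order of queries are arbitrary but fixed. "A.a.s." means with probability tending to $1$ as $k\to\infty$.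
   Formalization: The sufficiently large constant $c$ ranges over the rationals, so $p=c/k$ is rational as well. -}

module Defs where

open import Data.Nat as ℕ using (ℕ; zero; suc; _≤_)
open import Data.Fin using (Fin) renaming (_≟_ to _≟F_)
open import Data.Bool using (Bool; true; false; if_then_else_; _∧_; _∨_; not)
open import Data.List using (List; []; _∷_; length; allFin; filterᵇ)
open import Data.Maybe using (Maybe; just; nothing)
open import Data.Product using (_×_; _,_)
open import Data.Integer using (+_)
open import Relation.Nullary.Decidable using (⌊_⌋)
open import Relation.Binary.PropositionalEquality using (_≡_)
open import Data.Rational as ℚ using (ℚ; 0ℚ; 1ℚ; _+_; _*_; _-_; _/_; _≤ᵇ_)

record Graph (n : ℕ) : Set where
  field
    adj    : Fin n → Fin n → Bool
    sym    : ∀ v w → adj v w ≡ adj w v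
    irrefl : ∀ v → adj v v ≡ false
open Graph public

degree : ∀ {n} → Graph n → Fin n → ℕ
degree {n} G v = length (filterᵇ (adj G v) (allFin n))

MinDegree≥ : ∀ {n} → Graph n → ℕ → Set
MinDegree≥ {n} G k = ∀ (v : Fin n) → k ≤ degree G v

-- The "arbitrary but fixed" choices of the DFS algorithm, as deterministic
-- functions of the history (the list of query answers received so far, which
-- determines the whole run).  'root h' is the preferred new root and
-- 'query h' the preferred next neighbour to query; if the preferred vertex is
-- not an admissible candidate, the least admissible candidate is used.  Thus
-- every deterministic choice rule is represented.
record Strategy (n : ℕ) : Set where
  field
    root  : List Bool → Fin n
    query : List Bool → Fin n
open Strategy public

pick : ∀ {n} → (Fin n → Bool) → Fin n → Maybe (Fin n)
pick {n} cand x with cand x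
... | true = just x
... | false with filterᵇ cand (allFin n)
...   | [] = nothing
...   | y ∷ _ = just y

-- State of the DFS algorithm: U (as indicator), the stack S (head = top),
-- the list of tested edges (as ordered pairs (v , w), v the queried top
-- vertex), and the history of answers.  R is the complement of U ∪ S.
record State (n : ℕ) : Set where
  field
    unvis  : Fin n → Bool
    stack  : List (Fin n)
    tested : List (Fin n × Fin n)
    hist   : List Bool
open State public

eqF : ∀ {n} → Fin n → Fin n → Bool
eqF a b = ⌊ a ≟F b ⌋

isTested : ∀ {n} → List (Fin n × Fin n) → Fin n → Fin n → Bool
isTested [] v w = false
isTested ((a , b) ∷ es) v w =
  (eqF a v ∧ eqF b w) ∨ (eqF a w ∧ eqF b v) ∨ isTested es v w

remove : ∀ {n} → (Fin n → Bool) → Fin n → Fin n → Bool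
remove U r x = U x ∧ not (eqF x r)

indicator : Bool → ℚ
indicator true  = 1ℚ
indicator false = 0ℚ

module DFS {n : ℕ} (G : Graph n) (σ : Strategy n) (p : ℚ)
           (E : ℕ → Bool) where
  -- With fuel the number of
  -- rounds; n*n + 2n + 1 rounds always suffice.
  go : ℕ → State n → ℚ
  go zero st = indicator (E (length (tested st)))
  go (suc f) st with stack st
  ... | [] with pick (unvis st) (root σ (hist st))
  ...   | nothing = indicator (E (length (tested st)))
  ...   | just r = go f record st { unvis = remove (unvis st) r ; stack = r ∷ [] }
  go (suc f) st | v ∷ vs with pick (λ w → adj G v w ∧ unvis st w ∧ not (isTested (tested st) v w))
                                   (query σ (hist st))
  ... | nothing = go f record st { stack = vs }
  ... | just w =
        p * go f record st { unvis = remove (unvis st) w ; stack = w ∷ v ∷ vs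
                           ; tested = (v , w) ∷ tested st ; hist = true ∷ hist st }
      + (1ℚ - p) * go f record st { tested = (v , w) ∷ tested st ; hist = false ∷ hist st }

  initial : State n
  initial = record { unvis = λ _ → true ; stack = [] ; tested = [] ; hist = [] }

  prob : ℚ
  prob = go (n ℕ.* n ℕ.+ 2 ℕ.* n ℕ.+ 1) initial

ℕtoℚ : ℕ → ℚ
ℕtoℚ m = (+ m) / 1

ProbTooManyTested : ∀ {n} → Graph n → Strategy n → ℚ → (k : ℕ) → .{{_ : ℕ.NonZero k}} → ℚ
ProbTooManyTested {n} G σ c k =
  DFS.prob G σ p (λ t → not ((ℕtoℚ t * p) ≤ᵇ ℕtoℚ (2 ℕ.* n)))
  where p = c * ((+ 1) / k)

{-# OPTIONS --safe #-}
-- Let s be the number of vertices already reached (n − |U|) and t the number of tested edges.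
-- Each test increases t by one and, with probability p, also s; so X = s − tp moves like a
-- martingale with increments of variance p(1 − p) ≤ p, while s ≤ n throughout.  Testing more
-- than 2n/p edges forces X < −n.  Hence (min(X, 0)² + 2n − tp) / n² is a supermartingale along
-- the run that is ≥ 1 once tp > 2n and equals 2/n initially, so the probability of testing more
-- than 2n/p edges is at most 2/n ≤ 2/k.
module Submission where

open import Defs hiding (sym)
open import Data.Bool using (Bool; true; false; T; not; _∧_)
open import Data.Bool.Properties using (T-∧)
open import Data.Fin using (Fin) renaming (_≟_ to _≟F_)
open import Data.Integer as ℤ using (+_)
import Data.Integer.Properties as ℤ
import Data.Integer.Tactic.RingSolver as ℤ-Solver
open import Data.List using ([]; _∷_; length; allFin; filterᵇ)
open import Data.List.Membership.Propositional using (_∈_)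
open import Data.List.Membership.Propositional.Properties using (∈-filter⁺; ∈-filter⁻; ∈-allFin)
open import Data.List.Properties using (length-filter; length-tabulate)
open import Data.List.Relation.Binary.Pointwise using (Pointwise-≡⇒≡)
open import Data.List.Relation.Binary.Sublist.Heterogeneous.Properties using (length-mono-≤; toPointwise)
open import Data.List.Relation.Binary.Sublist.Propositional using (_⊆_; ⊆-refl)
open import Data.List.Relation.Binary.Sublist.Propositional.Properties using (filter⁺)
open import Data.List.Relation.Unary.Any using (here)
open import Data.Maybe using (just; nothing)
open import Data.Nat as ℕ using (ℕ; zero; suc; z≤n)
import Data.Nat.Properties as ℕ
import Data.Nat.Coprimality as Coprime
open import Data.Product using (Σ; _,_; proj₁; proj₂)
open import Data.Rational as ℚ
  using (ℚ; 0ℚ; 1ℚ; toℚᵘ; _+_; _*_; _-_; -_; _≤_; _<_; _⊓_; _≤ᵇ_)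
open import Data.Rational.Properties
import Data.Rational.Unnormalised as ℚᵘ
import Data.Rational.Unnormalised.Properties as ℚᵘ
open import Data.Sum using (inj₁; inj₂)
open import Data.Unit using (tt)
open import Function using (_∘_; id; Equivalence)
open import Level using (0ℓ)
open import Relation.Binary.PropositionalEquality
open import Relation.Nullary using (¬_; yes; no)
open import Relation.Nullary.Decidable using (dec⇒maybe; T?)
open import Tactic.RingSolver using (solve-∀)
import Tactic.RingSolver.Core.AlmostCommutativeRing as ACR

open Equivalence using (to)

ℚ-ring : ACR.AlmostCommutativeRing 0ℓ 0ℓ
ℚ-ring = ACR.fromCommutativeRing +-*-commutativeRing λ x → dec⇒maybe (0ℚ ≟ x)

*-monoˡ-≤-≥0 : ∀ {r p q} → 0ℚ ≤ r → p ≤ q → r * p ≤ r * q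
*-monoˡ-≤-≥0 {r} 0≤r = *-monoˡ-≤-nonNeg r {{ℚ.nonNegative 0≤r}}

*-≥0 : ∀ {p q} → 0ℚ ≤ p → 0ℚ ≤ q → 0ℚ ≤ p * q
*-≥0 {p} 0≤p 0≤q = subst (_≤ p * _) (*-zeroʳ p) (*-monoˡ-≤-≥0 0≤p 0≤q)

p≤q⇒0≤q-p : ∀ {p q} → p ≤ q → 0ℚ ≤ q - p
p≤q⇒0≤q-p {p} {q} p≤q = subst (_≤ q - p) (+-inverseʳ p) (+-monoˡ-≤ (- p) p≤q)

p≤q⇒p-q≤0 : ∀ {p q} → p ≤ q → p - q ≤ 0ℚ
p≤q⇒p-q≤0 {p} {q} p≤q = subst (p - q ≤_) (+-inverseʳ q) (+-monoˡ-≤ (- q) p≤q)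

p≤p+q : ∀ p {q} → 0ℚ ≤ q → p ≤ p + q
p≤p+q p 0≤q = subst (_≤ p + _) (+-identityʳ p) (+-monoʳ-≤ p 0≤q)

p-q≤p : ∀ p {q} → 0ℚ ≤ q → p - q ≤ p
p-q≤p p 0≤q = subst (p - _ ≤_) (+-identityʳ p) (+-monoʳ-≤ p (neg-antimono-≤ 0≤q))

sq-≥0 : ∀ p → 0ℚ ≤ p * p
sq-≥0 p with ≤-total 0ℚ p
... | inj₁ 0≤p = *-≥0 0≤p 0≤p
... | inj₂ p≤0 = subst (_≤ p * p) (*-zeroʳ p) (*-monoˡ-≤-nonPos p {{ℚ.nonPositive p≤0}} p≤0)

sq-antimono-≤0 : ∀ {p q} → p ≤ q → q ≤ 0ℚ → q * q ≤ p * p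
sq-antimono-≤0 {p} {q} p≤q q≤0 = begin
  q * q ≤⟨ *-monoʳ-≤-nonPos q {{ℚ.nonPositive q≤0}} p≤q ⟩
  p * q ≤⟨ *-monoˡ-≤-nonPos p {{ℚ.nonPositive (≤-trans p≤q q≤0)}} p≤q ⟩
  p * p ∎
  where open ≤-Reasoning

ℕtoℚ-+ : ∀ m k → ℕtoℚ (m ℕ.+ k) ≡ ℕtoℚ m + ℕtoℚ k
ℕtoℚ-+ m k = toℚᵘ-injective (begin
  toℚᵘ (ℕtoℚ (m ℕ.+ k))                ≈⟨ toℚᵘ-fromℚᵘ (ℚᵘ.mkℚᵘ (+ (m ℕ.+ k)) 0) ⟩
  ℚᵘ.mkℚᵘ (+ (m ℕ.+ k)) 0               ≈⟨ ℚᵘ.*≡* (sum-over-one (+ m) (+ k)) ⟩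
  ℚᵘ.mkℚᵘ (+ m) 0 ℚᵘ.+ ℚᵘ.mkℚᵘ (+ k) 0  ≈⟨ ℚᵘ.+-cong (toℚᵘ-fromℚᵘ (ℚᵘ.mkℚᵘ (+ m) 0))
                                                     (toℚᵘ-fromℚᵘ (ℚᵘ.mkℚᵘ (+ k) 0)) ⟨
  toℚᵘ (ℕtoℚ m) ℚᵘ.+ toℚᵘ (ℕtoℚ k)      ≈⟨ toℚᵘ-homo-+ (ℕtoℚ m) (ℕtoℚ k) ⟨
  toℚᵘ (ℕtoℚ m + ℕtoℚ k)                ∎)
  where
  open import Relation.Binary.Reasoning.Setoid ℚᵘ.≃-setoid
  sum-over-one : ∀ x y → (x ℤ.+ y) ℤ.* + 1 ≡ (x ℤ.* + 1 ℤ.+ y ℤ.* + 1) ℤ.* + 1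
  sum-over-one = solve-∀ ℤ-Solver.ring

ℕtoℚ-suc : ∀ m → ℕtoℚ (suc m) ≡ ℕtoℚ m + 1ℚ
ℕtoℚ-suc m = trans (ℕtoℚ-+ 1 m) (+-comm 1ℚ (ℕtoℚ m))

ℕtoℚ-≥0 : ∀ m → 0ℚ ≤ ℕtoℚ m
ℕtoℚ-≥0 m = nonNegative⁻¹ (ℕtoℚ m) {{normalize-nonNeg m 1}}

ℕtoℚ-mono-≤ : ∀ {m k} → m ℕ.≤ k → ℕtoℚ m ≤ ℕtoℚ k
ℕtoℚ-mono-≤ {m} {k} m≤k = subst (ℕtoℚ m ≤_) k≡m+[k-m] (p≤p+q (ℕtoℚ m) (ℕtoℚ-≥0 (k ℕ.∸ m)))
  where
  k≡m+[k-m] : ℕtoℚ m + ℕtoℚ (k ℕ.∸ m) ≡ ℕtoℚ k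
  k≡m+[k-m] = trans (sym (ℕtoℚ-+ m (k ℕ.∸ m))) (cong ℕtoℚ (ℕ.m+[n∸m]≡n m≤k))

ℕtoℚ-pos : ∀ {n} → 0 ℕ.< n → 0ℚ < ℕtoℚ n
ℕtoℚ-pos n>0 = <-≤-trans (positive⁻¹ 1ℚ) (ℕtoℚ-mono-≤ n>0)

negPart² : ℚ → ℚ
negPart² y = (y ⊓ 0ℚ) * (y ⊓ 0ℚ)

negPart²-≤0 : ∀ {y} → y ≤ 0ℚ → negPart² y ≡ y * y
negPart²-≤0 y≤0 = cong (λ m → m * m) (p≤q⇒p⊓q≡p y≤0)

negPart²≤sq : ∀ {x y} → x ≤ y → negPart² y ≤ x * x
negPart²≤sq {x} {y} x≤y with ≤-total y 0ℚ
... | inj₁ y≤0 rewrite negPart²-≤0 y≤0 = sq-antimono-≤0 x≤y y≤0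
... | inj₂ 0≤y rewrite p≥q⇒p⊓q≡q 0≤y = sq-≥0 x

negPart²-antimono : ∀ {x y} → x ≤ y → negPart² y ≤ negPart² x
negPart²-antimono {x} x≤y = negPart²≤sq (≤-trans (p⊓q≤p x 0ℚ) x≤y)

two-point-second-moment : ∀ p m →
  p * ((m + (1ℚ - p)) * (m + (1ℚ - p))) + (1ℚ - p) * ((m - p) * (m - p)) ≡ (m * m + p) - p * p
two-point-second-moment = solve-∀ ℚ-ring

negPart²-step : ∀ {p} → 0ℚ ≤ p → p ≤ 1ℚ → ∀ y →
  p * negPart² (y + (1ℚ - p)) + (1ℚ - p) * negPart² (y - p) ≤ negPart² y + p
negPart²-step {p} 0≤p p≤1 y = begin
  p * negPart² (y + (1ℚ - p)) + (1ℚ - p) * negPart² (y - p)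
    ≤⟨ +-mono-≤ (*-monoˡ-≤-≥0 0≤p (negPart²≤sq (+-monoˡ-≤ (1ℚ - p) m≤y)))
                (*-monoˡ-≤-≥0 (p≤q⇒0≤q-p p≤1) (negPart²≤sq (+-monoˡ-≤ (- p) m≤y))) ⟩
  p * ((m + (1ℚ - p)) * (m + (1ℚ - p))) + (1ℚ - p) * ((m - p) * (m - p))
    ≡⟨ two-point-second-moment p m ⟩
  (m * m + p) - p * p
    ≤⟨ p-q≤p (m * m + p) (sq-≥0 p) ⟩
  negPart² y + p ∎
  where
  open ≤-Reasoning
  m : ℚ
  m = y ⊓ 0ℚ
  m≤y : m ≤ y
  m≤y = p⊓q≤p y 0ℚ

potential : ℚ → ℚ → ℚ → ℚ
potential N S T = negPart² (S - T) + (N + N - T)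

potential-antimono : ∀ N {S S′} T → S ≤ S′ → potential N S′ T ≤ potential N S T
potential-antimono N T S≤S′ = +-monoˡ-≤ (N + N - T) (negPart²-antimono (+-monoˡ-≤ (- T) S≤S′))

potential-≥0 : ∀ N S {T} → T ≤ N + N → 0ℚ ≤ potential N S T
potential-≥0 N S {T} T≤2N = +-mono-≤ (sq-≥0 ((S - T) ⊓ 0ℚ)) (p≤q⇒0≤q-p T≤2N)

potential-step : ∀ {p} → 0ℚ ≤ p → p ≤ 1ℚ → ∀ N S T →
  p * potential N (S + 1ℚ) (T + p) + (1ℚ - p) * potential N S (T + p) ≤ potential N S T
potential-step {p} 0≤p p≤1 N S T = begin
  p * potential N (S + 1ℚ) (T + p) + (1ℚ - p) * potential N S (T + p)
    ≡⟨ cong₂ (λ u w → p * (negPart² u + V) + (1ℚ - p) * (negPart² w + V))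
             (shift₁ S T p) (shift₂ S T p) ⟩
  p * (negPart² (Y + (1ℚ - p)) + V) + (1ℚ - p) * (negPart² (Y - p) + V)
    ≡⟨ mix p (negPart² (Y + (1ℚ - p))) (negPart² (Y - p)) V ⟩
  p * negPart² (Y + (1ℚ - p)) + (1ℚ - p) * negPart² (Y - p) + V
    ≤⟨ +-monoˡ-≤ V (negPart²-step 0≤p p≤1 Y) ⟩
  negPart² Y + p + (N + N - (T + p))
    ≡⟨ drift (negPart² Y) p (N + N) T ⟩
  negPart² Y + (N + N - T) ∎
  where
  open ≤-Reasoning
  Y V : ℚ
  Y = S - T
  V = N + N - (T + p)
  shift₁ : ∀ S T p → S + 1ℚ - (T + p) ≡ (S - T) + (1ℚ - p)
  shift₁ = solve-∀ ℚ-ring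
  shift₂ : ∀ S T p → S - (T + p) ≡ (S - T) - p
  shift₂ = solve-∀ ℚ-ring
  mix : ∀ p a b v → p * (a + v) + (1ℚ - p) * (b + v) ≡ p * a + (1ℚ - p) * b + v
  mix = solve-∀ ℚ-ring
  drift : ∀ a p B T → a + p + (B - (T + p)) ≡ a + (B - T)
  drift = solve-∀ ℚ-ring

potential-threshold : ∀ {N S T} → 1ℚ ≤ N → S ≤ N → N + N < T → N * N ≤ potential N S T
potential-threshold {N} {S} {T} 1≤N S≤N 2N<T = begin
  N * N
    ≤⟨ p≤p+q (N * N) (*-≥0 (p≤q⇒0≤q-p (<⇒≤ 2N<T)) (p≤q⇒0≤q-p 1≤T)) ⟩
  N * N + (T - (N + N)) * (T - 1ℚ)
    ≡⟨ expand N T ⟩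
  (N - T) * (N - T) + (N + N - T)
    ≤⟨ +-monoˡ-≤ (N + N - T) (sq-antimono-≤0 S-T≤N-T N-T≤0) ⟩
  (S - T) * (S - T) + (N + N - T)
    ≡⟨ cong (_+ (N + N - T)) (negPart²-≤0 (≤-trans S-T≤N-T N-T≤0)) ⟨
  potential N S T ∎
  where
  open ≤-Reasoning
  N≤2N : N ≤ N + N
  N≤2N = p≤p+q N (≤-trans (nonNegative⁻¹ 1ℚ) 1≤N)
  1≤T : 1ℚ ≤ T
  1≤T = ≤-trans 1≤N (≤-trans N≤2N (<⇒≤ 2N<T))
  S-T≤N-T : S - T ≤ N - T
  S-T≤N-T = +-monoˡ-≤ (- T) S≤N
  N-T≤0 : N - T ≤ 0ℚ
  N-T≤0 = p≤q⇒p-q≤0 (≤-trans N≤2N (<⇒≤ 2N<T))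
  expand : ∀ N T → N * N + (T - (N + N)) * (T - 1ℚ) ≡ (N - T) * (N - T) + (N + N - T)
  expand = solve-∀ ℚ-ring

module _ {n : ℕ} where

  count : (Fin n → Bool) → ℕ
  count U = length (filterᵇ U (allFin n))

  count≤n : ∀ U → count U ℕ.≤ n
  count≤n U = ℕ.≤-trans (length-filter (T? ∘ U) (allFin n)) (ℕ.≤-reflexive (length-tabulate id))

  _⊆ᵇ_ : (Fin n → Bool) → (Fin n → Bool) → Set
  V ⊆ᵇ U = ∀ {x} → T (V x) → T (U x)

  filter-allFin-⊆ : ∀ {V U} → V ⊆ᵇ U → filterᵇ V (allFin n) ⊆ filterᵇ U (allFin n)
  filter-allFin-⊆ {V} {U} V⊆U = filter⁺ (T? ∘ V) (T? ∘ U) (λ { refl → V⊆U }) (⊆-refl {x = allFin n})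

  count-mono : ∀ {V U} → V ⊆ᵇ U → count V ℕ.≤ count U
  count-mono V⊆U = length-mono-≤ (filter-allFin-⊆ V⊆U)

  count-mono-< : ∀ {V U w} → V ⊆ᵇ U → T (U w) → ¬ T (V w) → count V ℕ.< count U
  count-mono-< {V} {U} {w} V⊆U Uw ¬Vw = ℕ.≤∧≢⇒< (count-mono V⊆U) counts-differ
    where
    counts-differ : count V ≢ count U
    counts-differ eq = ¬Vw (proj₂ (∈-filter⁻ (T? ∘ V) {xs = allFin n} w∈V))
      where
      V≡U : filterᵇ V (allFin n) ≡ filterᵇ U (allFin n)
      V≡U = Pointwise-≡⇒≡ (toPointwise eq (filter-allFin-⊆ V⊆U))
      w∈V : w ∈ filterᵇ V (allFin n)
      w∈V = subst (w ∈_) (sym V≡U) (∈-filter⁺ (T? ∘ U) (∈-allFin w) Uw)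

  visited : (Fin n → Bool) → ℕ
  visited U = n ℕ.∸ count U

  visited≤n : ∀ U → visited U ℕ.≤ n
  visited≤n U = ℕ.m∸n≤m n (count U)

  remove-⊆ : ∀ U r → remove U r ⊆ᵇ U
  remove-⊆ U r = proj₁ ∘ to T-∧

  visited-remove-≤ : ∀ U r → visited U ℕ.≤ visited (remove U r)
  visited-remove-≤ U r = ℕ.∸-monoʳ-≤ n (count-mono (remove-⊆ U r))

  visited-remove-< : ∀ U {w} → T (U w) → visited U ℕ.< visited (remove U w)
  visited-remove-< U {w} Uw = ℕ.∸-monoʳ-< (count-mono-< (remove-⊆ U w) Uw w∉) (count≤n U)
    where
    w∉ : ¬ T (remove U w w)
    w∉ h with w ≟F w
    ... | yes _ = proj₂ (to T-∧ h)
    ... | no w≢w = w≢w refl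

  pick-sound : ∀ cand x {y} → pick cand x ≡ just y → T (cand y)
  pick-sound cand x eq with cand x in cx
  ... | true with refl ← eq = subst T (sym cx) tt
  pick-sound cand x eq | false with filterᵇ cand (allFin n) in picked
  ... | y ∷ _ with refl ← eq =
    proj₂ (∈-filter⁻ (T? ∘ cand) {xs = allFin n} (subst (y ∈_) (sym picked) (here refl)))

-- Optional stopping: a potential in (tested, visited) that dominates the event and is
-- superharmonic for the walk bounds the probability of the event.
module _ {n : ℕ} (G : Graph n) (σ : Strategy n) {p : ℚ} (0≤p : 0ℚ ≤ p) (p≤1 : p ≤ 1ℚ)
         {E : ℕ → Bool} (Ψ : ℕ → ℕ → ℚ)
         (Ψ-bound : ∀ t s → s ℕ.≤ n → indicator (E t) ≤ Ψ t s)
         (Ψ-antimono : ∀ t {s s′} → s ℕ.≤ s′ → Ψ t s′ ≤ Ψ t s)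
         (Ψ-step : ∀ t s → p * Ψ (suc t) (suc s) + (1ℚ - p) * Ψ (suc t) s ≤ Ψ t s)
         where

  open DFS G σ p E

  go≤Ψ : ∀ fuel st → go fuel st ≤ Ψ (length (tested st)) (visited (unvis st))
  go≤Ψ zero st = Ψ-bound _ _ (visited≤n (unvis st))
  go≤Ψ (suc fuel) st with stack st
  ... | [] with pick (unvis st) (root σ (hist st))
  ...   | nothing = Ψ-bound _ _ (visited≤n (unvis st))
  ...   | just r = ≤-trans (go≤Ψ fuel _) (Ψ-antimono _ (visited-remove-≤ (unvis st) r))
  go≤Ψ (suc fuel) st | v ∷ vs
    with pick (λ w → adj G v w ∧ unvis st w ∧ not (isTested (tested st) v w)) (query σ (hist st)) in picked
  ... | nothing = go≤Ψ fuel _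
  ... | just w = begin
    p * go fuel _ + (1ℚ - p) * go fuel _
      ≤⟨ +-mono-≤ (*-monoˡ-≤-≥0 0≤p (go≤Ψ fuel _)) (*-monoˡ-≤-≥0 (p≤q⇒0≤q-p p≤1) (go≤Ψ fuel _)) ⟩
    p * Ψ (suc t) (visited (remove U w)) + (1ℚ - p) * Ψ (suc t) s
      ≤⟨ +-monoˡ-≤ _ (*-monoˡ-≤-≥0 0≤p (Ψ-antimono (suc t) (visited-remove-< U Uw))) ⟩
    p * Ψ (suc t) (suc s) + (1ℚ - p) * Ψ (suc t) s
      ≤⟨ Ψ-step t s ⟩
    Ψ t s ∎
    where
    open ≤-Reasoning
    U : Fin n → Bool
    U = unvis st
    t s : ℕ
    t = length (tested st)
    s = visited U
    Uw : T (U w)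
    Uw = proj₁ (to T-∧ (proj₂ (to (T-∧ {adj G v w}) (pick-sound candidate _ picked))))
      where
      candidate : Fin n → Bool
      candidate w = adj G v w ∧ U w ∧ not (isTested (tested st) v w)

  prob≤Ψ : prob ≤ Ψ 0 0
  prob≤Ψ = ≤-trans (go≤Ψ (n ℕ.* n ℕ.+ 2 ℕ.* n ℕ.+ 1) initial) (Ψ-antimono 0 z≤n)

ℕtoℚ-double : ∀ m → ℕtoℚ (2 ℕ.* m) ≡ ℕtoℚ m + ℕtoℚ m
ℕtoℚ-double m = trans (ℕtoℚ-+ m (m ℕ.+ 0)) (cong (λ k → ℕtoℚ m + ℕtoℚ k) (ℕ.+-identityʳ m))

indicator-not-≤ᵇ : ∀ {x y z} → (x ≤ y → 0ℚ ≤ z) → (y < x → 1ℚ ≤ z) → indicator (not (x ≤ᵇ y)) ≤ z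
indicator-not-≤ᵇ {x} {y} below above with x ≤ᵇ y in x≤ᵇy
... | true = below (≤ᵇ⇒≤ (subst T (sym x≤ᵇy) tt))
... | false = above (≰⇒> (λ x≤y → subst T x≤ᵇy (≤⇒≤ᵇ x≤y)))

module _ {n : ℕ} (n>0 : 0 ℕ.< n) {p : ℚ} (0≤p : 0ℚ ≤ p) (p≤1 : p ≤ 1ℚ) where

  private
    N : ℚ
    N = ℕtoℚ n
    1≤N : 1ℚ ≤ N
    1≤N = ℕtoℚ-mono-≤ n>0
    instance
      N>0 : ℚ.Positive N
      N>0 = ℚ.positive (ℕtoℚ-pos n>0)
      N²>0 : ℚ.Positive (N * N)
      N²>0 = pos*pos⇒pos N N
      N²≢0 : ℚ.NonZero (N * N)
      N²≢0 = pos⇒nonZero (N * N)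
    a : ℚ
    a = ℚ.1/ (N * N)
    0≤a : 0ℚ ≤ a
    0≤a = <⇒≤ (positive⁻¹ a {{1/pos⇒pos (N * N)}})

  tooMany : ℕ → Bool
  tooMany t = not (ℕtoℚ t * p ≤ᵇ ℕtoℚ (2 ℕ.* n))

  Ψ : ℕ → ℕ → ℚ
  Ψ t s = a * potential N (ℕtoℚ s) (ℕtoℚ t * p)

  Ψ-bound : ∀ t s → s ℕ.≤ n → indicator (tooMany t) ≤ Ψ t s
  Ψ-bound t s s≤n = indicator-not-≤ᵇ
    (λ below → *-≥0 0≤a (potential-≥0 N (ℕtoℚ s) (subst (_ ≤_) (ℕtoℚ-double n) below)))
    (λ above → begin
      1ℚ          ≡⟨ *-inverseˡ (N * N) ⟨
      a * (N * N) ≤⟨ *-monoˡ-≤-≥0 0≤a (potential-threshold 1≤N (ℕtoℚ-mono-≤ s≤n)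
                                         (subst (_< _) (ℕtoℚ-double n) above)) ⟩
      Ψ t s       ∎)
    where open ≤-Reasoning

  Ψ-antimono : ∀ t {s s′} → s ℕ.≤ s′ → Ψ t s′ ≤ Ψ t s
  Ψ-antimono t s≤s′ = *-monoˡ-≤-≥0 0≤a (potential-antimono N _ (ℕtoℚ-mono-≤ s≤s′))

  Ψ-step : ∀ t s → p * Ψ (suc t) (suc s) + (1ℚ - p) * Ψ (suc t) s ≤ Ψ t s
  Ψ-step t s = begin
    p * Ψ (suc t) (suc s) + (1ℚ - p) * Ψ (suc t) s
      ≡⟨ cong₂ (λ x y → p * (a * potential N x y) + (1ℚ - p) * (a * potential N S y))
               (ℕtoℚ-suc s) (trans (cong (_* p) (ℕtoℚ-suc t)) (distribʳ-suc (ℕtoℚ t) p)) ⟩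
    p * (a * potential N (S + 1ℚ) (tp + p)) + (1ℚ - p) * (a * potential N S (tp + p))
      ≡⟨ mix-scale p a _ _ ⟩
    a * (p * potential N (S + 1ℚ) (tp + p) + (1ℚ - p) * potential N S (tp + p))
      ≤⟨ *-monoˡ-≤-≥0 0≤a (potential-step 0≤p p≤1 N S tp) ⟩
    Ψ t s ∎
    where
    open ≤-Reasoning
    S tp : ℚ
    S = ℕtoℚ s
    tp = ℕtoℚ t * p
    distribʳ-suc : ∀ x p → (x + 1ℚ) * p ≡ x * p + p
    distribʳ-suc = solve-∀ ℚ-ring
    mix-scale : ∀ p a u v → p * (a * u) + (1ℚ - p) * (a * v) ≡ a * (p * u + (1ℚ - p) * v)
    mix-scale = solve-∀ ℚ-ring

  Ψ-start : N * Ψ 0 0 ≡ 1ℚ + 1ℚ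
  Ψ-start = begin
    N * (a * potential N 0ℚ (0ℚ * p)) ≡⟨ cong (λ x → N * (a * potential N 0ℚ x)) (*-zeroˡ p) ⟩
    N * (a * potential N 0ℚ 0ℚ)       ≡⟨ cong (λ x → N * (a * x)) (trans (+-identityˡ _) (+-identityʳ _)) ⟩
    N * (a * (N + N))                 ≡⟨ regroup N a ⟩
    a * (N * N) * (1ℚ + 1ℚ)           ≡⟨ cong (_* (1ℚ + 1ℚ)) (*-inverseˡ (N * N)) ⟩
    1ℚ * (1ℚ + 1ℚ)                    ≡⟨ *-identityˡ (1ℚ + 1ℚ) ⟩
    1ℚ + 1ℚ                           ∎
    where
    open ≡-Reasoning
    regroup : ∀ N a → N * (a * (N + N)) ≡ a * (N * N) * (1ℚ + 1ℚ)
    regroup = solve-∀ ℚ-ring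

  tooManyTested≤2/n : (G : Graph n) (σ : Strategy n) → N * DFS.prob G σ p tooMany ≤ 1ℚ + 1ℚ
  tooManyTested≤2/n G σ = begin
    N * DFS.prob G σ p tooMany ≤⟨ *-monoˡ-≤-≥0 (<⇒≤ (ℕtoℚ-pos n>0))
                                     (prob≤Ψ G σ 0≤p p≤1 Ψ Ψ-bound Ψ-antimono Ψ-step) ⟩
    N * Ψ 0 0                  ≡⟨ Ψ-start ⟩
    1ℚ + 1ℚ                    ∎
    where open ≤-Reasoning

ℕtoℚ≡mkℚ : ∀ m → ℕtoℚ m ≡ ℚ.mkℚ (+ m) 0 (Coprime.sym (Coprime.1-coprimeTo m))
ℕtoℚ≡mkℚ m = normalize-coprime (Coprime.sym (Coprime.1-coprimeTo m))

natAbove : ℚ → ℕ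
natAbove q = ℤ.∣ ℚ.↥ q ∣

≤-natAbove : ∀ q → q ≤ ℕtoℚ (natAbove q)
≤-natAbove (ℚ.mkℚ (+ m) d _) rewrite ℕtoℚ≡mkℚ m =
  ℚ.*≤* (subst₂ ℤ._≤_ (ℤ.pos-* m 1) (ℤ.pos-* m (suc d))
                       (ℤ.+≤+ (ℕ.*-monoʳ-≤ m (ℕ.s≤s z≤n))))
≤-natAbove q@(ℚ.mkℚ ℤ.-[1+ m ] _ _) = ≤-trans (nonPositive⁻¹ q) (ℕtoℚ-≥0 (suc m))

ℕtoℚ-*-1/ : ∀ k .{{_ : ℕ.NonZero k}} → ℕtoℚ k * ((+ 1) ℚ./ k) ≡ 1ℚ
ℕtoℚ-*-1/ (suc k) rewrite ℕtoℚ≡mkℚ (suc k) | normalize-coprime {1} {k} (Coprime.1-coprimeTo (suc k)) =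
  *-inverseʳ (ℚ.mkℚ (+ suc k) 0 (Coprime.sym (Coprime.1-coprimeTo (suc k))))

module _ {c ε : ℚ} (0≤c : 0ℚ ≤ c) (0<ε : 0ℚ < ε) where

  instance
    ε≢0 : ℚ.NonZero ε
    ε≢0 = pos⇒nonZero ε {{ℚ.positive 0<ε}}

  2/ε : ℚ
  2/ε = (1ℚ + 1ℚ) ℚ.÷ ε

  K : ℕ
  K = natAbove c ℕ.+ natAbove 2/ε

  K≤⇒c≤ : ∀ {k} → K ℕ.≤ k → c ≤ ℕtoℚ k
  K≤⇒c≤ K≤k =
    ≤-trans (≤-natAbove c) (ℕtoℚ-mono-≤ (ℕ.≤-trans (ℕ.m≤m+n (natAbove c) (natAbove 2/ε)) K≤k))

  K≤⇒2≤*ε : ∀ {k} → K ℕ.≤ k → 1ℚ + 1ℚ ≤ ℕtoℚ k * ε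
  K≤⇒2≤*ε {k} K≤k = begin
    1ℚ + 1ℚ                 ≡⟨ *-identityʳ (1ℚ + 1ℚ) ⟨
    (1ℚ + 1ℚ) * 1ℚ          ≡⟨ cong ((1ℚ + 1ℚ) *_) (*-inverseˡ ε) ⟨
    (1ℚ + 1ℚ) * (ℚ.1/ ε * ε) ≡⟨ *-assoc (1ℚ + 1ℚ) (ℚ.1/ ε) ε ⟨
    2/ε * ε                 ≤⟨ *-monoʳ-≤-nonNeg ε {{ℚ.nonNegative (<⇒≤ 0<ε)}} 2/ε≤k ⟩
    ℕtoℚ k * ε              ∎
    where
    open ≤-Reasoning
    2/ε≤k : 2/ε ≤ ℕtoℚ k
    2/ε≤k =
      ≤-trans (≤-natAbove 2/ε) (ℕtoℚ-mono-≤ (ℕ.≤-trans (ℕ.m≤n+m (natAbove 2/ε) (natAbove c)) K≤k))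

  tooManyTested-≤ε : ∀ k .{{_ : ℕ.NonZero k}} → K ℕ.≤ k → ∀ n (G : Graph n) → MinDegree≥ G k →
                     ∀ σ → ProbTooManyTested G σ c k ≤ ε
  tooManyTested-≤ε k K≤k n G δ≥k σ =
    *-cancelˡ-≤-pos N {{ℚ.positive (ℕtoℚ-pos n>0)}}
      (≤-trans (tooManyTested≤2/n n>0 0≤p p≤1 G σ) (K≤⇒2≤*ε (ℕ.≤-trans K≤k k≤n)))
    where
    N r p : ℚ
    N = ℕtoℚ n
    r = (+ 1) ℚ./ k
    p = c * r
    instance
      r≥0 : ℚ.NonNegative r
      r≥0 = normalize-nonNeg 1 k
    0≤p : 0ℚ ≤ p
    0≤p = *-≥0 0≤c (nonNegative⁻¹ r)
    p≤1 : p ≤ 1ℚ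
    p≤1 = ≤-trans (*-monoʳ-≤-nonNeg r (K≤⇒c≤ K≤k)) (≤-reflexive (ℕtoℚ-*-1/ k))
    -- A strategy names a root, so G has a vertex and the degree condition gives k ≤ n.
    k≤n : k ℕ.≤ n
    k≤n = ℕ.≤-trans (δ≥k (root σ [])) (count≤n (adj G (root σ [])))
    n>0 : 0 ℕ.< n
    n>0 = ℕ.≤-trans (ℕ.>-nonZero⁻¹ k) k≤n

lemma7 : Σ ℚ λ c₀ → ∀ (c : ℚ) → c₀ ℚ.≤ c →
           ∀ (ε : ℚ) → 0ℚ ℚ.< ε →
           Σ ℕ λ K → ∀ (k : ℕ) .{{_ : ℕ.NonZero k}} → K ℕ.≤ k →
           ∀ (n : ℕ) (G : Graph n) → MinDegree≥ G k →
           ∀ (σ : Strategy n) → ProbTooManyTested G σ c k ℚ.≤ ε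
lemma7 = 0ℚ , λ c 0≤c ε 0<ε → K 0≤c 0<ε , tooManyTested-≤ε 0≤c 0<ε
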